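{- Let $w\ge 1$, $k\ge 2$ be integers and $a,b,c,r$ integers with $0\le a,b,c,r<w$. Consider the $\texttt{xoroshiro++}$ generator with $w$ bits of output and $kw$ bits of state, i.e. state $(s_0,\dots,s_{k-1})$ of $w$-bit words with next-state map \[ s'_j=s_{j+1}\ (0\le j\le k-3),\quad s'_{k-2}=\mathrm{rotl}(s_0,a)\oplus s_0\oplus s_{k-1}\oplus\bigl((s_0\oplus s_{k-1})\ll b\bigr),\quad s'_{k-1}=\mathrm{rotl}(s_0\oplus s_{k-1},c). \] (1) If the output is $\mathrm{rotl}(s_{k-1}+s_0,r)+s_{k-1}$ (scrambling the last and first word of state), the generator is $(k-1)$-dimensionally equidistributed. (2) If $k=2$ and the output is $\mathrm{rotl}(s_0+s_{1},r)+s_0$ (scrambling the first and last word of state), the generator is $1$-dimensionally equidistributed.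
   Context: A $w$-bit word is an element of $\{0,1\}^w$, identified with an integer in $[0,2^w)$. $\oplus$ is bitwise xor, $x\ll b$ is $x\cdot 2^b\bmod 2^w$, $\mathrm{rotl}(x,r)$ is left rotation by $r$ positions, and $+$ between words is addition in $\mathbf Z/2^w\mathbf Z$. A generator with $kw$ bits of state, next-state map $T$ and $w$-bit output function $\varphi$ is $d$-dimensionally equidistributed ($d\le k$) if, as $s$ ranges over all nonzero states, every $d$-tuple $(\varphi(s),\varphi(Ts),\dots,\varphi(T^{d-1}s))$ appears exactly $2^{w(k-d)}$ times, except the all-zero $d$-tuple, which appears $2^{w(k-d)}-1$ times. -}

module Defs where

open import Data.Bool using (Bool; true; false; _xor_)
open import Data.Nat using (ℕ; zero; suc; _+_; _*_; _∸_; _^_; _%_; _/_)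
open import Data.Vec using (Vec; []; _∷_; zipWith; replicate; init; last; _∷ʳ_)
open import Data.Vec.Properties using (≡-dec)
open import Data.List using (List; []; _∷_; concatMap; map; filter; length)
open import Data.Product using (_×_)
open import Relation.Binary.PropositionalEquality using (_≡_)
open import Relation.Nullary using (¬_)
open import Relation.Nullary.Decidable using (¬?; _×-dec_)
import Data.Bool.Properties as BoolP

-- A w-bit word: little-endian bit vector (index 0 = least significant bit).
Word : ℕ → Set
Word w = Vec Bool w

toℕ : ∀ {w} → Word w → ℕ
toℕ []       = 0
toℕ (b ∷ v)  = bitVal b + 2 * toℕ v
  where
  bitVal : Bool → ℕ
  bitVal true  = 1
  bitVal false = 0

fromℕ : ∀ w → ℕ → Word w
fromℕ zero    n = []
fromℕ (suc w) n = (n % 2 Data.Nat.≡ᵇ 1) ∷ fromℕ w (n / 2)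

zeroW : ∀ {w} → Word w
zeroW = replicate _ false

_⊕_ : ∀ {w} → Word w → Word w → Word w
_⊕_ = zipWith _xor_

_⊞_ : ∀ {w} → Word w → Word w → Word w
_⊞_ {w} x y = fromℕ w (toℕ x + toℕ y)

_≪_ : ∀ {w} → Word w → ℕ → Word w
_≪_ {w} x b = fromℕ w (toℕ x * 2 ^ b)

rotl1 : ∀ {w} → Word w → Word w
rotl1 {zero}  x = x
rotl1 {suc w} x = last x ∷ init x

rotl : ∀ {w} → Word w → ℕ → Word w
rotl x zero    = x
rotl x (suc r) = rotl1 (rotl x r)

_≟W_ : ∀ {w} (x y : Word w) → Relation.Nullary.Dec (x ≡ y)
_≟W_ = ≡-dec BoolP._≟_

State : ℕ → ℕ → Set
State w k = Vec (Word w) k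

_≟S_ : ∀ {w k} (x y : State w k) → Relation.Nullary.Dec (x ≡ y)
_≟S_ = ≡-dec _≟W_

zeroS : ∀ {w k} → State w k
zeroS = replicate _ zeroW

allVecs : ∀ {A : Set} → List A → (n : ℕ) → List (Vec A n)
allVecs xs zero    = [] ∷ []
allVecs xs (suc n) = concatMap (λ x → map (x ∷_) (allVecs xs n)) xs

allWords : (w : ℕ) → List (Word w)
allWords w = allVecs (false ∷ true ∷ []) w

allStates : (w k : ℕ) → List (State w k)
allStates w k = allVecs (allWords w) k

xoroshiro : ∀ {w m} (a b c : ℕ) → State w (suc (suc m)) → State w (suc (suc m))
xoroshiro a b c (s₀ ∷ rest) =
  (init rest ∷ʳ (((rotl s₀ a ⊕ s₀) ⊕ sₗ) ⊕ ((s₀ ⊕ sₗ) ≪ b))) ∷ʳ rotl (s₀ ⊕ sₗ) c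
  where sₗ = last rest

first : ∀ {w m} → State w (suc m) → Word w
first (s₀ ∷ _) = s₀

lastW : ∀ {w m} → State w (suc m) → Word w
lastW = last

outputs : ∀ {w k} → (State w k → State w k) → (State w k → Word w) →
          (d : ℕ) → State w k → Vec (Word w) d
outputs T φ zero    s = []
outputs T φ (suc d) s = φ s ∷ outputs T φ d (T s)

countTuple : ∀ {w k} → (State w k → State w k) → (State w k → Word w) →
             (d : ℕ) → Vec (Word w) d → ℕ
countTuple {w} {k} T φ d t =
  length (filter (λ s → ¬? (s ≟S zeroS) ×-dec (outputs T φ d s ≟S t)) (allStates w k))

Equidistributed : ∀ {w k} → (State w k → State w k) → (State w k → Word w) → ℕ → Set
Equidistributed {w} {k} T φ d =
  (t : Vec (Word w) d) →
    (t ≡ replicate d zeroW → countTuple T φ d t ≡ 2 ^ (w * (k ∸ d)) ∸ 1) ×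
    (¬ t ≡ replicate d zeroW → countTuple T φ d t ≡ 2 ^ (w * (k ∸ d)))

outLastFirst : ∀ {w m} → ℕ → State w (suc m) → Word w
outLastFirst r s = rotl (lastW s ⊞ first s) r ⊞ lastW s

outFirstLast : ∀ {w m} → ℕ → State w (suc m) → Word w
outFirstLast r s = rotl (first s ⊞ lastW s) r ⊞ first s

module Submission where

-- Write k = m + 2. For i ≤ m the first word of Tⁱ s is sᵢ, and the last word Lᵢ of Tⁱ s satisfies
-- L₀ = s_{k-1} and L_{i+1} = rotl(sᵢ ⊕ Lᵢ, c). The i-th output rotl(Lᵢ + sᵢ, r) + Lᵢ is, for fixed
-- Lᵢ, a bijection in sᵢ (subtract Lᵢ, rotate back, subtract Lᵢ again). So the first k - 1 outputs,
-- together with s_{k-1}, determine the state: s ↦ (s_{k-1}, outputs) is a bijection of the state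
-- space fixing 0. The nonzero states with a given output tuple t therefore correspond to the 2^w
-- choices of s_{k-1}, minus the one making the whole state zero when t = 0. For k = 2 and the
-- output rotl(s₀ + s₁, r) + s₀ the same argument applies to s ↦ (s₀, output).

open import Defs
open import Data.Bool using (Bool; true; false; _xor_)
open import Data.Nat
  using (ℕ; zero; suc; _+_; _*_; _∸_; _^_; _%_; _/_; _≡ᵇ_; _≤_; _<_; s≤s; NonZero)
open import Data.Nat.Properties
open import Data.Nat.DivMod
open import Data.Nat.Divisibility using (divides; divides-refl)
open import Data.Vec using (Vec; []; _∷_; tail; replicate; init; last; _∷ʳ_; initLast)
open import Data.Vec.Properties using (init-∷ʳ; last-∷ʳ; zipWith-replicate; ≡-dec; ∷-injective)
open import Data.Product using (_×_; _,_; proj₁; proj₂)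
open import Data.List using (List; []; _∷_; _++_; map; concatMap; filter; length)
open import Data.Empty using (⊥-elim)
open import Function using (_∘_)
open import Relation.Nullary using (Dec; yes; no; ¬_)
open import Relation.Nullary.Decidable using (¬?; _×-dec_)
open import Relation.Unary using (Decidable)
open import Relation.Binary.Definitions using (DecidableEquality)
open import Relation.Binary.PropositionalEquality
open import Algebra.Properties.CommutativeSemigroup +-commutativeSemigroup
  using (x∙yz≈y∙xz; interchange)

private variable
  A B : Set

-- Word arithmetic modulo 2^w

bit : Bool → ℕ
bit false = 0
bit true  = 1

toℕ-∷ : ∀ {w} b (v : Word w) → toℕ (b ∷ v) ≡ bit b + toℕ v * 2
toℕ-∷ false v = *-comm 2 (toℕ v)
toℕ-∷ true  v = cong suc (*-comm 2 (toℕ v))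

bit-parity : ∀ n → bit (n % 2 ≡ᵇ 1) ≡ n % 2
bit-parity n with n % 2 | m%n<n n 2
... | 0           | _             = refl
... | 1           | _             = refl
... | suc (suc _) | s≤s (s≤s ())

fromℕ-bit : ∀ w b n → fromℕ (suc w) (bit b + n * 2) ≡ b ∷ fromℕ w n
fromℕ-bit w b n = cong₂ _∷_
  (trans (cong (_≡ᵇ 1) ([m+kn]%n≡m%n (bit b) n 2)) (bit%2 b))
  (cong (fromℕ w) (trans (+-distrib-/-∣ʳ (bit b) (divides-refl n))
                         (cong₂ _+_ (bit/2 b) (m*n/n≡m n 2))))
  where
  bit%2 : ∀ b → (bit b % 2 ≡ᵇ 1) ≡ b
  bit%2 false = refl
  bit%2 true  = refl
  bit/2 : ∀ b → bit b / 2 ≡ 0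
  bit/2 false = refl
  bit/2 true  = refl

fromℕ-toℕ : ∀ {w} (x : Word w) → fromℕ w (toℕ x) ≡ x
fromℕ-toℕ []              = refl
fromℕ-toℕ {suc w} (b ∷ v) = begin
  fromℕ (suc w) (toℕ (b ∷ v))        ≡⟨ cong (fromℕ (suc w)) (toℕ-∷ b v) ⟩
  fromℕ (suc w) (bit b + toℕ v * 2)  ≡⟨ fromℕ-bit w b (toℕ v) ⟩
  b ∷ fromℕ w (toℕ v)                ≡⟨ cong (b ∷_) (fromℕ-toℕ v) ⟩
  b ∷ v                              ∎
  where open ≡-Reasoning

toℕ-fromℕ : ∀ w n .{{_ : NonZero (2 ^ w)}} → toℕ (fromℕ w n) ≡ n % 2 ^ w
toℕ-fromℕ zero    n = sym (n%1≡0 n)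
toℕ-fromℕ (suc w) n = begin
  toℕ (fromℕ (suc w) n)
    ≡⟨ toℕ-∷ (n % 2 ≡ᵇ 1) (fromℕ w (n / 2)) ⟩
  bit (n % 2 ≡ᵇ 1) + toℕ (fromℕ w (n / 2)) * 2
    ≡⟨ cong₂ (λ l h → l + h * 2) (bit-parity n) (toℕ-fromℕ w (n / 2)) ⟩
  n % 2 + n / 2 % 2 ^ w * 2
    ≡⟨ cong₂ (λ l h → l + h * 2) (m∣n⇒o%n%m≡o%m 2 M n (divides (2 ^ w) refl))
                                 (m%[n*o]/o≡m/o%n n (2 ^ w) 2) ⟨
  n % M % 2 + n % M / 2 * 2
    ≡⟨ m≡m%n+[m/n]*n (n % M) 2 ⟨
  n % M
    ≡⟨ %-congʳ (*-comm (2 ^ w) 2) ⟩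
  n % 2 ^ suc w
    ∎
  where
  open ≡-Reasoning
  M = 2 ^ w * 2
  instance
    _ = m^n≢0 2 w
    _ = m*n≢0 (2 ^ w) 2

[m+n%d]%d≡[m+n]%d : ∀ m n d .{{_ : NonZero d}} → (m + n % d) % d ≡ (m + n) % d
[m+n%d]%d≡[m+n]%d m n d = begin
  (m + n % d) % d          ≡⟨ %-distribˡ-+ m (n % d) d ⟩
  (m % d + n % d % d) % d  ≡⟨ cong (λ k → (m % d + k) % d) (m%n%n≡m%n n d) ⟩
  (m % d + n % d) % d      ≡⟨ %-distribˡ-+ m n d ⟨
  (m + n) % d              ∎
  where open ≡-Reasoning

infix 30 ⊟_
⊟_ : ∀ {w} → Word w → Word w
⊟_ {w} x = fromℕ w (2 ^ w ∸ toℕ x)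

module _ {w : ℕ} where
  private instance
    2^w≢0 : NonZero (2 ^ w)
    2^w≢0 = m^n≢0 2 w

  toℕ-injective : {x y : Word w} → toℕ x ≡ toℕ y → x ≡ y
  toℕ-injective {x} {y} eq = trans (sym (fromℕ-toℕ x)) (trans (cong (fromℕ w) eq) (fromℕ-toℕ y))

  toℕ%2^w≡toℕ : (x : Word w) → toℕ x % 2 ^ w ≡ toℕ x
  toℕ%2^w≡toℕ x = trans (sym (toℕ-fromℕ w (toℕ x))) (cong toℕ (fromℕ-toℕ x))

  toℕ<2^w : (x : Word w) → toℕ x < 2 ^ w
  toℕ<2^w x = subst (_< 2 ^ w) (toℕ%2^w≡toℕ x) (m%n<n (toℕ x) (2 ^ w))

  toℕ-⊞-⊞ : (x y z : Word w) → toℕ (x ⊞ (y ⊞ z)) ≡ (toℕ x + (toℕ y + toℕ z)) % 2 ^ w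
  toℕ-⊞-⊞ x y z = begin
    toℕ (x ⊞ (y ⊞ z))                          ≡⟨ toℕ-fromℕ w _ ⟩
    (toℕ x + toℕ (y ⊞ z)) % 2 ^ w              ≡⟨ cong (λ k → (toℕ x + k) % 2 ^ w) (toℕ-fromℕ w _) ⟩
    (toℕ x + (toℕ y + toℕ z) % 2 ^ w) % 2 ^ w  ≡⟨ [m+n%d]%d≡[m+n]%d (toℕ x) _ (2 ^ w) ⟩
    (toℕ x + (toℕ y + toℕ z)) % 2 ^ w          ∎
    where open ≡-Reasoning

  ⊞-comm : (x y : Word w) → x ⊞ y ≡ y ⊞ x
  ⊞-comm x y = cong (fromℕ w) (+-comm (toℕ x) (toℕ y))

  x⊞[y⊞z]≡y⊞[x⊞z] : (x y z : Word w) → x ⊞ (y ⊞ z) ≡ y ⊞ (x ⊞ z)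
  x⊞[y⊞z]≡y⊞[x⊞z] x y z = toℕ-injective (begin
    toℕ (x ⊞ (y ⊞ z))                  ≡⟨ toℕ-⊞-⊞ x y z ⟩
    (toℕ x + (toℕ y + toℕ z)) % 2 ^ w  ≡⟨ cong (_% 2 ^ w) (x∙yz≈y∙xz (toℕ x) (toℕ y) (toℕ z)) ⟩
    (toℕ y + (toℕ x + toℕ z)) % 2 ^ w  ≡⟨ toℕ-⊞-⊞ y x z ⟨
    toℕ (y ⊞ (x ⊞ z))                  ∎)
    where open ≡-Reasoning

  ⊟x⊞[x⊞y]≡y : (x y : Word w) → ⊟ x ⊞ (x ⊞ y) ≡ y
  ⊟x⊞[x⊞y]≡y x y = toℕ-injective (begin
    toℕ (⊟ x ⊞ (x ⊞ y))
      ≡⟨ toℕ-fromℕ w _ ⟩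
    (toℕ (⊟ x) + toℕ (x ⊞ y)) % 2 ^ w
      ≡⟨ cong₂ (λ a b → (a + b) % 2 ^ w) (toℕ-fromℕ w _) (toℕ-fromℕ w _) ⟩
    ((2 ^ w ∸ toℕ x) % 2 ^ w + (toℕ x + toℕ y) % 2 ^ w) % 2 ^ w
      ≡⟨ %-distribˡ-+ (2 ^ w ∸ toℕ x) _ (2 ^ w) ⟨
    (2 ^ w ∸ toℕ x + (toℕ x + toℕ y)) % 2 ^ w
      ≡⟨ cong (_% 2 ^ w) (+-assoc (2 ^ w ∸ toℕ x) (toℕ x) (toℕ y)) ⟨
    (2 ^ w ∸ toℕ x + toℕ x + toℕ y) % 2 ^ w
      ≡⟨ cong (λ k → (k + toℕ y) % 2 ^ w) (m∸n+n≡m (<⇒≤ (toℕ<2^w x))) ⟩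
    (2 ^ w + toℕ y) % 2 ^ w
      ≡⟨ cong (_% 2 ^ w) (+-comm (2 ^ w) (toℕ y)) ⟩
    (toℕ y + 2 ^ w) % 2 ^ w
      ≡⟨ [m+n]%n≡m%n (toℕ y) (2 ^ w) ⟩
    toℕ y % 2 ^ w
      ≡⟨ toℕ%2^w≡toℕ y ⟩
    toℕ y
      ∎)
    where open ≡-Reasoning

  x⊞[⊟x⊞y]≡y : (x y : Word w) → x ⊞ (⊟ x ⊞ y) ≡ y
  x⊞[⊟x⊞y]≡y x y = trans (x⊞[y⊞z]≡y⊞[x⊞z] x (⊟ x) y) (⊟x⊞[x⊞y]≡y x y)

init-∷ʳ-last : ∀ {n} (xs : Vec A (suc n)) → init xs ∷ʳ last xs ≡ xs
init-∷ʳ-last xs = sym (proj₂ (proj₂ (initLast xs)))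

replicate-∷ʳ : ∀ n (x : A) → replicate (suc n) x ≡ replicate n x ∷ʳ x
replicate-∷ʳ zero    x = refl
replicate-∷ʳ (suc n) x = cong (x ∷_) (replicate-∷ʳ n x)

rotr1 : ∀ {w} → Word w → Word w
rotr1 []       = []
rotr1 (x ∷ xs) = xs ∷ʳ x

rotl1-rotr1 : ∀ {w} (x : Word w) → rotl1 (rotr1 x) ≡ x
rotl1-rotr1 []       = refl
rotl1-rotr1 (x ∷ xs) = cong₂ _∷_ (last-∷ʳ x xs) (init-∷ʳ x xs)

rotr1-rotl1 : ∀ {w} (x : Word w) → rotr1 (rotl1 x) ≡ x
rotr1-rotl1 []        = refl
rotr1-rotl1 x@(_ ∷ _) = init-∷ʳ-last x

rotr : ∀ {w} → Word w → ℕ → Word w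
rotr x zero    = x
rotr x (suc r) = rotr (rotr1 x) r

rotl-rotr : ∀ {w} (x : Word w) r → rotl (rotr x r) r ≡ x
rotl-rotr x zero    = refl
rotl-rotr x (suc r) = trans (cong rotl1 (rotl-rotr (rotr1 x) r)) (rotl1-rotr1 x)

rotr-rotl : ∀ {w} (x : Word w) r → rotr (rotl x r) r ≡ x
rotr-rotl x zero    = refl
rotr-rotl x (suc r) = trans (cong (λ y → rotr y r) (rotr1-rotl1 (rotl x r))) (rotr-rotl x r)

toℕ-zeroW : ∀ {w} → toℕ (zeroW {w}) ≡ 0
toℕ-zeroW {zero}  = refl
toℕ-zeroW {suc w} = cong (2 *_) (toℕ-zeroW {w})

zeroW⊞zeroW : ∀ {w} → zeroW ⊞ zeroW ≡ zeroW {w}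
zeroW⊞zeroW {w} = trans (cong (fromℕ w) (trans (cong₂ _+_ z z) (sym z))) (fromℕ-toℕ zeroW)
  where z = toℕ-zeroW {w}

zeroW⊕zeroW : ∀ {w} → zeroW ⊕ zeroW ≡ zeroW {w}
zeroW⊕zeroW = zipWith-replicate _xor_ false false

rotl1-zeroW : ∀ {w} → rotl1 (zeroW {w}) ≡ zeroW
rotl1-zeroW {zero}  = refl
rotl1-zeroW {suc w} = trans (cong rotl1 (replicate-∷ʳ w false)) (rotl1-rotr1 zeroW)

rotl-zeroW : ∀ {w} r → rotl (zeroW {w}) r ≡ zeroW
rotl-zeroW zero    = refl
rotl-zeroW (suc r) = trans (cong rotl1 (rotl-zeroW r)) rotl1-zeroW

scramble : ∀ {w} → ℕ → Word w → Word w → Word w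
scramble r x y = rotl (x ⊞ y) r ⊞ x

unscramble : ∀ {w} → ℕ → Word w → Word w → Word w
unscramble r x o = ⊟ x ⊞ rotr (⊟ x ⊞ o) r

scramble-unscramble : ∀ {w} r (x o : Word w) → scramble r x (unscramble r x o) ≡ o
scramble-unscramble r x o = begin
  rotl (x ⊞ (⊟ x ⊞ rotr (⊟ x ⊞ o) r)) r ⊞ x  ≡⟨ cong (λ y → rotl y r ⊞ x) (x⊞[⊟x⊞y]≡y x _) ⟩
  rotl (rotr (⊟ x ⊞ o) r) r ⊞ x              ≡⟨ cong (_⊞ x) (rotl-rotr (⊟ x ⊞ o) r) ⟩
  (⊟ x ⊞ o) ⊞ x                              ≡⟨ ⊞-comm (⊟ x ⊞ o) x ⟩
  x ⊞ (⊟ x ⊞ o)                              ≡⟨ x⊞[⊟x⊞y]≡y x o ⟩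
  o                                          ∎
  where open ≡-Reasoning

unscramble-scramble : ∀ {w} r (x y : Word w) → unscramble r x (scramble r x y) ≡ y
unscramble-scramble r x y = begin
  ⊟ x ⊞ rotr (⊟ x ⊞ (rotl (x ⊞ y) r ⊞ x)) r  ≡⟨ cong (λ z → ⊟ x ⊞ rotr (⊟ x ⊞ z) r)
                                                    (⊞-comm (rotl (x ⊞ y) r) x) ⟩
  ⊟ x ⊞ rotr (⊟ x ⊞ (x ⊞ rotl (x ⊞ y) r)) r  ≡⟨ cong (λ z → ⊟ x ⊞ rotr z r) (⊟x⊞[x⊞y]≡y x _) ⟩
  ⊟ x ⊞ rotr (rotl (x ⊞ y) r) r              ≡⟨ cong (⊟ x ⊞_) (rotr-rotl (x ⊞ y) r) ⟩
  ⊟ x ⊞ (x ⊞ y)                              ≡⟨ ⊟x⊞[x⊞y]≡y x y ⟩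
  y                                          ∎
  where open ≡-Reasoning

unscramble-zeroW : ∀ {w} r → unscramble r zeroW zeroW ≡ zeroW {w}
unscramble-zeroW r = begin
  unscramble r zeroW zeroW                    ≡⟨ cong (unscramble r zeroW) scramble-zeroW ⟨
  unscramble r zeroW (scramble r zeroW zeroW) ≡⟨ unscramble-scramble r zeroW zeroW ⟩
  zeroW                                       ∎
  where
  open ≡-Reasoning
  scramble-zeroW : scramble r zeroW zeroW ≡ zeroW
  scramble-zeroW = trans (cong (λ y → rotl y r ⊞ zeroW) zeroW⊞zeroW)
                         (trans (cong (_⊞ zeroW) (rotl-zeroW r)) zeroW⊞zeroW)

module Chained {K : Set} (σ : K → A → B) (σ⁻¹ : K → B → A) (next : A → K → K) where

  encode : ∀ {n} → K → Vec A n → Vec B n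
  encode k []       = []
  encode k (y ∷ ys) = σ k y ∷ encode (next y k) ys

  decode : ∀ {n} → K → Vec B n → Vec A n
  decode k []       = []
  decode k (o ∷ os) = σ⁻¹ k o ∷ decode (next (σ⁻¹ k o) k) os

  decode-encode : (∀ k y → σ⁻¹ k (σ k y) ≡ y) →
                  ∀ {n} k (ys : Vec A n) → decode k (encode k ys) ≡ ys
  decode-encode σ⁻¹∘σ k []       = refl
  decode-encode σ⁻¹∘σ k (y ∷ ys) rewrite σ⁻¹∘σ k y = cong (y ∷_) (decode-encode σ⁻¹∘σ (next y k) ys)

  encode-decode : (∀ k o → σ k (σ⁻¹ k o) ≡ o) →
                  ∀ {n} k (os : Vec B n) → encode k (decode k os) ≡ os
  encode-decode σ∘σ⁻¹ k []       = refl
  encode-decode σ∘σ⁻¹ k (o ∷ os) = cong₂ _∷_ (σ∘σ⁻¹ k o) (encode-decode σ∘σ⁻¹ (next (σ⁻¹ k o) k) os)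

  decode-replicate : ∀ {k a b} → σ⁻¹ k b ≡ a → next a k ≡ k →
                     ∀ n → decode k (replicate n b) ≡ replicate n a
  decode-replicate σ⁻¹kb≡a next-a-k≡k zero    = refl
  decode-replicate σ⁻¹kb≡a next-a-k≡k (suc n) rewrite σ⁻¹kb≡a | next-a-k≡k =
    cong (_ ∷_) (decode-replicate σ⁻¹kb≡a next-a-k≡k n)

data Prefix {A : Set} : ∀ {m n} → Vec A m → Vec A n → Set where
  []  : ∀ {n} {ys : Vec A n} → Prefix [] ys
  _∷_ : ∀ {m n} x {xs : Vec A m} {ys : Vec A n} → Prefix xs ys → Prefix (x ∷ xs) (x ∷ ys)

Prefix-refl : ∀ {n} (xs : Vec A n) → Prefix xs xs
Prefix-refl []       = []
Prefix-refl (x ∷ xs) = x ∷ Prefix-refl xs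

Prefix-∷ʳ : ∀ {m n} {xs : Vec A m} {ys : Vec A n} y → Prefix xs ys → Prefix xs (ys ∷ʳ y)
Prefix-∷ʳ y []      = []
Prefix-∷ʳ y (x ∷ p) = x ∷ Prefix-∷ʳ y p

xoroshiroLast : ∀ {w} → ℕ → Word w → Word w → Word w
xoroshiroLast c s₀ sₗ = rotl (s₀ ⊕ sₗ) c

xoroshiroLast-zeroW : ∀ {w} c → xoroshiroLast c zeroW zeroW ≡ zeroW {w}
xoroshiroLast-zeroW c = trans (cong (λ x → rotl x c) zeroW⊕zeroW) (rotl-zeroW c)

last-xoroshiro : ∀ {w m} a b c (y : Word w) (rest : State w (suc m)) →
                 last (xoroshiro a b c (y ∷ rest)) ≡ xoroshiroLast c y (last rest)
last-xoroshiro a b c y rest = last-∷ʳ _ (init rest ∷ʳ _)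

Prefix-init-xoroshiro : ∀ {w m n} a b c (y : Word w) (rest : State w (suc m)) {p : Vec (Word w) n} →
                        Prefix p (init rest) → Prefix p (init (xoroshiro a b c (y ∷ rest)))
Prefix-init-xoroshiro a b c y rest {p} p⊑rest =
  subst (Prefix p) (sym (init-∷ʳ _ (init rest ∷ʳ _))) (Prefix-∷ʳ _ p⊑rest)

-- Counting over enumerations

∑ : List A → (A → ℕ) → ℕ
∑ []       f = 0
∑ (x ∷ xs) f = f x + ∑ xs f

𝟙 : ∀ {P : Set} → Dec P → ℕ
𝟙 (yes _) = 1
𝟙 (no _)  = 0

𝟙-yes : ∀ {P : Set} (p? : Dec P) → P → 𝟙 p? ≡ 1
𝟙-yes (yes _) p = refl
𝟙-yes (no ¬p) p = ⊥-elim (¬p p)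

𝟙-no : ∀ {P : Set} (p? : Dec P) → ¬ P → 𝟙 p? ≡ 0
𝟙-no (yes p) ¬p = ⊥-elim (¬p p)
𝟙-no (no _)  ¬p = refl

𝟙-⇔ : ∀ {P Q : Set} (p? : Dec P) (q? : Dec Q) → (P → Q) → (Q → P) → 𝟙 p? ≡ 𝟙 q?
𝟙-⇔ (yes p) q? P→Q Q→P = sym (𝟙-yes q? (P→Q p))
𝟙-⇔ (no ¬p) q? P→Q Q→P = sym (𝟙-no q? (¬p ∘ Q→P))

𝟙-¬ : ∀ {P : Set} (p? : Dec P) → 𝟙 (¬? p?) + 𝟙 p? ≡ 1
𝟙-¬ (yes _) = refl
𝟙-¬ (no _)  = refl

𝟙-× : ∀ {P Q : Set} (p? : Dec P) (q? : Dec Q) → 𝟙 (p? ×-dec q?) ≡ 𝟙 p? * 𝟙 q?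
𝟙-× (yes _) (yes _) = refl
𝟙-× (yes _) (no _)  = refl
𝟙-× (no _)  _       = refl

𝟙-sym : (_≟_ : DecidableEquality A) (x y : A) → 𝟙 (x ≟ y) ≡ 𝟙 (y ≟ x)
𝟙-sym _≟_ x y = 𝟙-⇔ (x ≟ y) (y ≟ x) sym sym

length-filter≡∑𝟙 : ∀ {P : A → Set} (P? : Decidable P) xs → length (filter P? xs) ≡ ∑ xs (𝟙 ∘ P?)
length-filter≡∑𝟙 P? []       = refl
length-filter≡∑𝟙 P? (x ∷ xs) with P? x
... | yes _ = cong suc (length-filter≡∑𝟙 P? xs)
... | no _  = length-filter≡∑𝟙 P? xs

∑-cong : (xs : List A) {f g : A → ℕ} → (∀ x → f x ≡ g x) → ∑ xs f ≡ ∑ xs g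
∑-cong []       f≗g = refl
∑-cong (x ∷ xs) f≗g = cong₂ _+_ (f≗g x) (∑-cong xs f≗g)

∑-zero : (xs : List A) → ∑ xs (λ _ → 0) ≡ 0
∑-zero []       = refl
∑-zero (x ∷ xs) = ∑-zero xs

∑-+ : (xs : List A) (f g : A → ℕ) → ∑ xs (λ x → f x + g x) ≡ ∑ xs f + ∑ xs g
∑-+ []       f g = refl
∑-+ (x ∷ xs) f g =
  trans (cong (f x + g x +_) (∑-+ xs f g)) (interchange (f x) (g x) (∑ xs f) (∑ xs g))

∑-* : (xs : List A) (c : ℕ) (f : A → ℕ) → ∑ xs (λ x → c * f x) ≡ c * ∑ xs f
∑-* []       c f = sym (*-zeroʳ c)
∑-* (x ∷ xs) c f = trans (cong (c * f x +_) (∑-* xs c f)) (sym (*-distribˡ-+ c (f x) (∑ xs f)))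

∑-++ : (xs ys : List A) (f : A → ℕ) → ∑ (xs ++ ys) f ≡ ∑ xs f + ∑ ys f
∑-++ []       ys f = refl
∑-++ (x ∷ xs) ys f = trans (cong (f x +_) (∑-++ xs ys f)) (sym (+-assoc (f x) _ _))

∑-map : (g : B → A) (ys : List B) (f : A → ℕ) → ∑ (map g ys) f ≡ ∑ ys (f ∘ g)
∑-map g []       f = refl
∑-map g (y ∷ ys) f = cong (f (g y) +_) (∑-map g ys f)

∑-concatMap : (h : B → List A) (ys : List B) (f : A → ℕ) →
              ∑ (concatMap h ys) f ≡ ∑ ys (λ y → ∑ (h y) f)
∑-concatMap h []       f = refl
∑-concatMap h (y ∷ ys) f =
  trans (∑-++ (h y) (concatMap h ys) f) (cong (∑ (h y) f +_) (∑-concatMap h ys f))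

∑-swap : (xs : List A) (ys : List B) (F : A → B → ℕ) →
         ∑ xs (λ x → ∑ ys (F x)) ≡ ∑ ys (λ y → ∑ xs (λ x → F x y))
∑-swap []       ys F = sym (∑-zero ys)
∑-swap (x ∷ xs) ys F = trans (cong (∑ ys (F x) +_) (∑-swap xs ys F)) (sym (∑-+ ys (F x) _))

∑-allVecs : (L : List A) (n : ℕ) (f : Vec A (suc n) → ℕ) →
            ∑ (allVecs L (suc n)) f ≡ ∑ L (λ x → ∑ (allVecs L n) (λ u → f (x ∷ u)))
∑-allVecs L n f = trans (∑-concatMap _ L f) (∑-cong L (λ x → ∑-map (x ∷_) (allVecs L n) f))

record Enumerates (_≟_ : DecidableEquality A) (L : List A) : Set where
  constructor occursOnce
  field once : ∀ x → ∑ L (λ y → 𝟙 (y ≟ x)) ≡ 1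
open Enumerates

∑-sift : {_≟_ : DecidableEquality A} {L : List A} → Enumerates _≟_ L →
         (f : A → ℕ) (t : A) → ∑ L (λ u → f u * 𝟙 (u ≟ t)) ≡ f t
∑-sift {_≟_ = _≟_} {L = L} enum f t = begin
  ∑ L (λ u → f u * 𝟙 (u ≟ t))  ≡⟨ ∑-cong L at-t ⟩
  ∑ L (λ u → f t * 𝟙 (u ≟ t))  ≡⟨ ∑-* L (f t) _ ⟩
  f t * ∑ L (λ u → 𝟙 (u ≟ t))  ≡⟨ cong (f t *_) (once enum t) ⟩
  f t * 1                      ≡⟨ *-identityʳ (f t) ⟩
  f t                          ∎
  where
  open ≡-Reasoning
  at-t : ∀ u → f u * 𝟙 (u ≟ t) ≡ f t * 𝟙 (u ≟ t)
  at-t u with u ≟ t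
  ... | yes refl = refl
  ... | no _     = trans (*-zeroʳ (f u)) (sym (*-zeroʳ (f t)))

∑-enumerations : {_≟_ : DecidableEquality A} {L₁ L₂ : List A} →
                 Enumerates _≟_ L₁ → Enumerates _≟_ L₂ → (f : A → ℕ) → ∑ L₁ f ≡ ∑ L₂ f
∑-enumerations {_≟_ = _≟_} {L₁ = L₁} {L₂ = L₂} enum₁ enum₂ f = begin
  ∑ L₁ f                                      ≡⟨ ∑-cong L₁ (∑-sift enum₂ f) ⟨
  ∑ L₁ (λ x → ∑ L₂ (λ y → f y * 𝟙 (y ≟ x)))  ≡⟨ ∑-swap L₁ L₂ _ ⟩
  ∑ L₂ (λ y → ∑ L₁ (λ x → f y * 𝟙 (y ≟ x)))  ≡⟨ ∑-cong L₂ (λ y → ∑-cong L₁ (λ x →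
                                                   cong (f y *_) (𝟙-sym _≟_ y x))) ⟩
  ∑ L₂ (λ y → ∑ L₁ (λ x → f y * 𝟙 (x ≟ y)))  ≡⟨ ∑-cong L₂ (λ y → ∑-sift enum₁ (λ _ → f y) y) ⟩
  ∑ L₂ f                                      ∎
  where open ≡-Reasoning

Enumerates-map : {_≟_ : DecidableEquality A} {L : List A} {g e : A → A} →
                 (∀ v → e (g v) ≡ v) → (∀ s → g (e s) ≡ s) →
                 Enumerates _≟_ L → Enumerates _≟_ (map g L)
Enumerates-map {_≟_ = _≟_} {L = L} {g = g} {e = e} e∘g g∘e enum = occursOnce λ x →
  trans (∑-map g L _)
        (trans (∑-cong L (λ v → 𝟙-⇔ (g v ≟ x) (v ≟ e x)
                                   (λ gv≡x → trans (sym (e∘g v)) (cong e gv≡x))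
                                   (λ v≡ex → trans (cong g v≡ex) (g∘e x))))
               (once enum (e x)))

∑-bijection : {_≟_ : DecidableEquality A} {L : List A} {g e : A → A} →
              (∀ v → e (g v) ≡ v) → (∀ s → g (e s) ≡ s) →
              Enumerates _≟_ L → (f : A → ℕ) → ∑ L f ≡ ∑ L (f ∘ g)
∑-bijection {L = L} {g = g} e∘g g∘e enum f =
  trans (∑-enumerations enum (Enumerates-map e∘g g∘e enum) f) (∑-map g L f)

Enumerates-allVecs : {_≟_ : DecidableEquality A} {L : List A} →
                     Enumerates _≟_ L → ∀ n → Enumerates (≡-dec _≟_) (allVecs L n)
Enumerates-allVecs enum zero = occursOnce λ { [] → refl }
Enumerates-allVecs {_≟_ = _≟_} {L = L} enum (suc n) = occursOnce λ { (x ∷ u) → begin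
  ∑ (allVecs L (suc n)) (λ v → 𝟙 (≡-dec _≟_ v (x ∷ u)))
    ≡⟨ ∑-allVecs L n _ ⟩
  ∑ L (λ z → ∑ (allVecs L n) (λ v → 𝟙 (≡-dec _≟_ (z ∷ v) (x ∷ u))))
    ≡⟨ ∑-cong L (λ z → ∑-cong (allVecs L n) (λ v → 𝟙-∷ z v x u)) ⟩
  ∑ L (λ z → ∑ (allVecs L n) (λ v → 𝟙 (z ≟ x) * 𝟙 (≡-dec _≟_ v u)))
    ≡⟨ ∑-cong L (λ z → ∑-sift (Enumerates-allVecs enum n) (λ _ → 𝟙 (z ≟ x)) u) ⟩
  ∑ L (λ z → 𝟙 (z ≟ x))
    ≡⟨ once enum x ⟩
  1 ∎ }
  where
  open ≡-Reasoning
  𝟙-∷ : ∀ z (v : Vec _ n) x u → 𝟙 (≡-dec _≟_ (z ∷ v) (x ∷ u)) ≡ 𝟙 (z ≟ x) * 𝟙 (≡-dec _≟_ v u)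
  𝟙-∷ z v x u = trans (𝟙-⇔ _ (z ≟ x ×-dec ≡-dec _≟_ v u) ∷-injective (λ (p , q) → cong₂ _∷_ p q))
                      (𝟙-× (z ≟ x) (≡-dec _≟_ v u))

Enumerates-allWords : ∀ w → Enumerates _≟W_ (allWords w)
Enumerates-allWords = Enumerates-allVecs (occursOnce λ { false → refl ; true → refl })

Enumerates-allStates : ∀ w k → Enumerates _≟S_ (allStates w k)
Enumerates-allStates w = Enumerates-allVecs (Enumerates-allWords w)

∑-allWords-1 : ∀ w → ∑ (allWords w) (λ _ → 1) ≡ 2 ^ w
∑-allWords-1 zero    = refl
∑-allWords-1 (suc w) = trans (∑-allVecs _ w _) (cong (λ k → k + (k + 0)) (∑-allWords-1 w))

-- Equidistribution

module _ {w d : ℕ} (t : State w d) where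

  ∑-nonzero-with-tail : ∑ (allStates w (suc d)) (λ v → 𝟙 (¬? (v ≟S zeroS) ×-dec (tail v ≟S t)))
                      ≡ ∑ (allWords w) (λ x → 𝟙 (¬? ((x ∷ t) ≟S zeroS)))
  ∑-nonzero-with-tail = trans (∑-allVecs (allWords w) d _) (∑-cong (allWords w) λ x →
    trans (∑-cong (allStates w d) (λ u → 𝟙-× (¬? ((x ∷ u) ≟S zeroS)) (u ≟S t)))
          (∑-sift (Enumerates-allStates w d) (λ u → 𝟙 (¬? ((x ∷ u) ≟S zeroS))) t))

  ∑-nonzero-∷-zero : t ≡ replicate d zeroW →
                     ∑ (allWords w) (λ x → 𝟙 (¬? ((x ∷ t) ≟S zeroS))) ≡ 2 ^ w ∸ 1
  ∑-nonzero-∷-zero t≡0 = begin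
    ∑ W (λ x → 𝟙 (¬? ((x ∷ t) ≟S zeroS)))
      ≡⟨ ∑-cong W (λ x → 𝟙-⇔ _ (¬? (x ≟W zeroW))
                            (λ x∷t≢0 x≡0 → x∷t≢0 (cong₂ _∷_ x≡0 t≡0))
                            (λ x≢0 x∷t≡0 → x≢0 (proj₁ (∷-injective x∷t≡0)))) ⟩
    ∑ W ≢0
      ≡⟨ m+n∸n≡m (∑ W ≢0) 1 ⟨
    ∑ W ≢0 + 1 ∸ 1
      ≡⟨ cong (λ k → ∑ W ≢0 + k ∸ 1) (once (Enumerates-allWords w) zeroW) ⟨
    ∑ W ≢0 + ∑ W (λ x → 𝟙 (x ≟W zeroW)) ∸ 1
      ≡⟨ cong (_∸ 1) (∑-+ W ≢0 _) ⟨
    ∑ W (λ x → 𝟙 (¬? (x ≟W zeroW)) + 𝟙 (x ≟W zeroW)) ∸ 1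
      ≡⟨ cong (_∸ 1) (∑-cong W (λ x → 𝟙-¬ (x ≟W zeroW))) ⟩
    ∑ W (λ _ → 1) ∸ 1
      ≡⟨ cong (_∸ 1) (∑-allWords-1 w) ⟩
    2 ^ w ∸ 1
      ∎
    where
    open ≡-Reasoning
    W = allWords w
    ≢0 : Word w → ℕ
    ≢0 x = 𝟙 (¬? (x ≟W zeroW))

  ∑-nonzero-∷-nonzero : ¬ t ≡ replicate d zeroW →
                        ∑ (allWords w) (λ x → 𝟙 (¬? ((x ∷ t) ≟S zeroS))) ≡ 2 ^ w
  ∑-nonzero-∷-nonzero t≢0 = trans
    (∑-cong (allWords w) (λ x → 𝟙-yes _ (λ x∷t≡0 → t≢0 (proj₂ (∷-injective x∷t≡0)))))
    (∑-allWords-1 w)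

equidistributed-by-bijection :
  ∀ {w d} (T : State w (suc d) → State w (suc d)) (φ : State w (suc d) → Word w)
  (e g : State w (suc d) → State w (suc d)) → (∀ s → tail (e s) ≡ outputs T φ d s) →
  (∀ v → e (g v) ≡ v) → (∀ s → g (e s) ≡ s) → g zeroS ≡ zeroS → Equidistributed T φ d
equidistributed-by-bijection {w} {d} T φ e g tail∘e e∘g g∘e g0≡0 t =
    (λ t≡0 → trans count (trans (∑-nonzero-∷-zero t t≡0) (cong (_∸ 1) (sym 2^[w*[1+d∸d]]))))
  , (λ t≢0 → trans count (trans (∑-nonzero-∷-nonzero t t≢0) (sym 2^[w*[1+d∸d]])))
  where
  open ≡-Reasoning
  S = allStates w (suc d)

  2^[w*[1+d∸d]] : 2 ^ (w * (suc d ∸ d)) ≡ 2 ^ w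
  2^[w*[1+d∸d]] = cong (2 ^_) (trans (cong (w *_) (m+n∸n≡m 1 d)) (*-identityʳ w))

  outputs∘g : ∀ v → outputs T φ d (g v) ≡ tail v
  outputs∘g v = trans (sym (tail∘e (g v))) (cong tail (e∘g v))

  g-reflects-zero : ∀ {v} → g v ≡ zeroS → v ≡ zeroS
  g-reflects-zero {v} gv≡0 =
    trans (sym (e∘g v)) (trans (cong e (trans gv≡0 (sym g0≡0))) (e∘g zeroS))

  count : countTuple T φ d t ≡ ∑ (allWords w) (λ x → 𝟙 (¬? ((x ∷ t) ≟S zeroS)))
  count = begin
    countTuple T φ d t
      ≡⟨ length-filter≡∑𝟙 _ S ⟩
    ∑ S (λ s → 𝟙 (¬? (s ≟S zeroS) ×-dec (outputs T φ d s ≟S t)))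
      ≡⟨ ∑-bijection e∘g g∘e (Enumerates-allStates w (suc d)) _ ⟩
    ∑ S (λ v → 𝟙 (¬? (g v ≟S zeroS) ×-dec (outputs T φ d (g v) ≟S t)))
      ≡⟨ ∑-cong S (λ v → 𝟙-⇔ _ _
           (λ (gv≢0 , o≡t) → (λ v≡0 → gv≢0 (trans (cong g v≡0) g0≡0))
                           , trans (sym (outputs∘g v)) o≡t)
           (λ (v≢0 , tl≡t) → (λ gv≡0 → v≢0 (g-reflects-zero gv≡0))
                           , trans (outputs∘g v) tl≡t)) ⟩
    ∑ S (λ v → 𝟙 (¬? (v ≟S zeroS) ×-dec (tail v ≟S t)))
      ≡⟨ ∑-nonzero-with-tail t ⟩
    ∑ (allWords w) (λ x → 𝟙 (¬? ((x ∷ t) ≟S zeroS)))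
      ∎

module _ {w m : ℕ} (a b c r : ℕ) where
  open Chained (scramble {w} r) (unscramble r) (xoroshiroLast c)

  outputs-prefix : ∀ {n} (p : Vec (Word w) n) (s : State w (suc (suc m))) → Prefix p (init s) →
                   outputs (xoroshiro a b c) (outLastFirst r) n s ≡ encode (last s) p
  outputs-prefix []      s           []            = refl
  outputs-prefix (y ∷ p) (.y ∷ rest) (.y ∷ p⊑rest) = cong (scramble r (last rest) y ∷_) (begin
    outputs (xoroshiro a b c) (outLastFirst r) _ (xoroshiro a b c (y ∷ rest))
      ≡⟨ outputs-prefix p _ (Prefix-init-xoroshiro a b c y rest p⊑rest) ⟩
    encode (last (xoroshiro a b c (y ∷ rest))) p
      ≡⟨ cong (λ L → encode L p) (last-xoroshiro a b c y rest) ⟩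
    encode (xoroshiroLast c y (last rest)) p
      ∎)
    where open ≡-Reasoning

  outputs-init : (s : State w (suc (suc m))) →
                 outputs (xoroshiro a b c) (outLastFirst r) (suc m) s ≡ encode (last s) (init s)
  outputs-init s = outputs-prefix (init s) s (Prefix-refl (init s))

  xoroshiro++-lastFirst-equidistributed :
    Equidistributed {w} {suc (suc m)} (xoroshiro a b c) (outLastFirst r) (suc m)
  xoroshiro++-lastFirst-equidistributed =
    equidistributed-by-bijection (xoroshiro a b c) (outLastFirst r) e g (λ _ → refl) e∘g g∘e g0≡0
    where
    open ≡-Reasoning
    e g : State w (suc (suc m)) → State w (suc (suc m))
    e s = last s ∷ outputs (xoroshiro a b c) (outLastFirst r) (suc m) s
    g (L ∷ os) = decode L os ∷ʳ L

    e∘g : ∀ v → e (g v) ≡ v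
    e∘g (L ∷ os) = let xs = decode L os in begin
      last (xs ∷ʳ L) ∷ outputs (xoroshiro a b c) (outLastFirst r) (suc m) (xs ∷ʳ L)
        ≡⟨ cong₂ _∷_ (last-∷ʳ L xs) (outputs-init (xs ∷ʳ L)) ⟩
      L ∷ encode (last (xs ∷ʳ L)) (init (xs ∷ʳ L))
        ≡⟨ cong (L ∷_) (cong₂ encode (last-∷ʳ L xs) (init-∷ʳ L xs)) ⟩
      L ∷ encode L xs
        ≡⟨ cong (L ∷_) (encode-decode (scramble-unscramble r) L os) ⟩
      L ∷ os ∎

    g∘e : ∀ s → g (e s) ≡ s
    g∘e s = begin
      decode (last s) (outputs (xoroshiro a b c) (outLastFirst r) (suc m) s) ∷ʳ last s
        ≡⟨ cong (λ os → decode (last s) os ∷ʳ last s) (outputs-init s) ⟩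
      decode (last s) (encode (last s) (init s)) ∷ʳ last s
        ≡⟨ cong (_∷ʳ last s) (decode-encode (unscramble-scramble r) (last s) (init s)) ⟩
      init s ∷ʳ last s
        ≡⟨ init-∷ʳ-last s ⟩
      s ∎

    g0≡0 : g zeroS ≡ zeroS
    g0≡0 = trans
      (cong (_∷ʳ zeroW) (decode-replicate (unscramble-zeroW r) (xoroshiroLast-zeroW c) (suc m)))
      (sym (replicate-∷ʳ (suc m) zeroW))

xoroshiro++-firstLast-equidistributed : ∀ {w} (a b c r : ℕ) →
  Equidistributed {w} {2} (xoroshiro a b c) (outFirstLast r) 1
xoroshiro++-firstLast-equidistributed {w} a b c r =
  equidistributed-by-bijection (xoroshiro a b c) (outFirstLast r) e g (λ _ → refl) e∘g g∘e
    (cong (λ y → zeroW ∷ y ∷ []) (unscramble-zeroW r))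
  where
  e g : State w 2 → State w 2
  e s            = first s ∷ outFirstLast r s ∷ []
  g (x ∷ o ∷ []) = x ∷ unscramble r x o ∷ []

  e∘g : ∀ v → e (g v) ≡ v
  e∘g (x ∷ o ∷ []) = cong (λ y → x ∷ y ∷ []) (scramble-unscramble r x o)

  g∘e : ∀ s → g (e s) ≡ s
  g∘e (x ∷ y ∷ []) = cong (λ z → x ∷ z ∷ []) (unscramble-scramble r x y)

proposition8p2 : (w m a b c r : ℕ) → 1 ≤ w → a < w → b < w → c < w → r < w →
    Equidistributed {w} {suc (suc m)} (xoroshiro a b c) (outLastFirst r) (suc m)
    × Equidistributed {w} {2} (xoroshiro a b c) (outFirstLast r) 1
proposition8p2 w m a b c r _ _ _ _ _ =
  xoroshiro++-lastFirst-equidistributed a b c r , xoroshiro++-firstLast-equidistributed a b c r
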